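{- Let $L,M,N$ be positive integers, at least one of them even, with $N\le M\le L$. Then $$\mathrm{maxtw}(L,M,N)\le\frac{LM\lceil N/2\rceil\lfloor N/2\rfloor}{4}\le\frac{LMN^2}{16}.$$
   Context: A basic cube is $[x,x+1]\times[y,y+1]\times[z,z+1]$, $(x,y,z)\in\mathbb{Z}^3$; white if $x+y+z$ even, black if odd. A domino is the union of two basic cubes sharing a face; a tiling of a region is a covering by dominoes with pairwise disjoint interiors. $\Phi=\{\pm e_x,\pm e_y,\pm e_z\}$. For a domino $d$, $v(d)\in\Phi$ is the center of its black cube minus that of its white cube; for $X\subset\mathbb{R}^3$, $u\in\Phi$, $S^u(X)$ is the interior of $(X+[0,\infty)u)\setminus X$; $\tau^u(d_0,d_1)=\tfrac14\det(v(d_1),v(d_0),u)$ if $d_1\cap S^u(d_0)\ne\emptyset$, else $0$; $T^u(t)=\sum_{d_0,d_1\in t}\tau^u(d_0,d_1)$ over ordered pairs. For a tiling $t$ of a box, $T^{e_x}(t)=T^{e_y}(t)=T^{e_z}(t)=:\mathrm{Tw}(t)$ (the twist). $\mathrm{maxtw}(L,M,N)$ is the maximum of $\mathrm{Tw}(t)$ over all tilings $t$ of $[0,L]\times[0,M]\times[0,N]$. -}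

module Defs where

open import Data.Nat as ℕ using (ℕ; _%_)
open import Data.Integer as ℤ using (ℤ; +_; ∣_∣)
open import Data.Rational as ℚ using (ℚ)
open import Data.Product using (_×_; _,_)
open import Data.Sum using (_⊎_)
open import Data.Bool using (Bool; true; false; if_then_else_; _∧_; _∨_; not)
open import Data.List using (List; []; _∷_; foldr; concatMap; map)
open import Data.Bool.ListAction using (any)
open import Data.List.Relation.Unary.All using (All)
open import Data.List.Relation.Unary.Any using (Any)
open import Data.List.Relation.Unary.AllPairs using (AllPairs)
open import Data.Empty using (⊥)
open import Relation.Nullary using (does)
open import Relation.Binary.PropositionalEquality using (_≡_)

-- Integer points / vectors of ℤ³.  The basic cube
-- [x,x+1]×[y,y+1]×[z,z+1] is identified with (x , y , z).

Z3 : Set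
Z3 = ℤ × ℤ × ℤ

Cube : Set
Cube = Z3

_⊕_ : Z3 → Z3 → Z3
(a , b , c) ⊕ (a' , b' , c') = (a ℤ.+ a') , (b ℤ.+ b') , (c ℤ.+ c')

_⊖_ : Z3 → Z3 → Z3
(a , b , c) ⊖ (a' , b' , c') = (a ℤ.- a') , (b ℤ.- b') , (c ℤ.- c')

_·_ : ℤ → Z3 → Z3
m · (a , b , c) = (m ℤ.* a) , (m ℤ.* b) , (m ℤ.* c)

dot : Z3 → Z3 → ℤ
dot (a , b , c) (a' , b' , c') = (a ℤ.* a') ℤ.+ (b ℤ.* b') ℤ.+ (c ℤ.* c')

_==_ : Z3 → Z3 → Bool
(a , b , c) == (a' , b' , c') =
  does (a ℤ.≟ a') ∧ does (b ℤ.≟ b') ∧ does (c ℤ.≟ c')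

det3 : Z3 → Z3 → Z3 → ℤ
det3 (p₁ , p₂ , p₃) (q₁ , q₂ , q₃) (r₁ , r₂ , r₃) =
  p₁ ℤ.* (q₂ ℤ.* r₃ ℤ.- q₃ ℤ.* r₂)
  ℤ.- p₂ ℤ.* (q₁ ℤ.* r₃ ℤ.- q₃ ℤ.* r₁)
  ℤ.+ p₃ ℤ.* (q₁ ℤ.* r₂ ℤ.- q₂ ℤ.* r₁)

data Axis : Set where
  ax ay az : Axis

e : Axis → Z3
e ax = + 1 , + 0 , + 0
e ay = + 0 , + 1 , + 0
e az = + 0 , + 0 , + 1

data Sign : Set where
  plus minus : Sign

Φ : Set
Φ = Sign × Axis

vec : Φ → Z3
vec (plus  , a) = e a
vec (minus , a) = (ℤ.- (+ 1)) · e a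

isWhite : Cube → Bool
isWhite (x , y , z) = does (∣ x ℤ.+ y ℤ.+ z ∣ % 2 ℕ.≟ 0)

-- Dominoes.  A domino (union of two face-adjacent basic cubes) is
-- represented uniquely by its lower cube `base` and the axis along
-- which it extends: its cubes are base and base + e_axis.

record Domino : Set where
  constructor dom
  field
    base : Cube
    axis : Axis
open Domino public

cube₁ cube₂ : Domino → Cube
cube₁ d = base d
cube₂ d = base d ⊕ e (axis d)

cubes : Domino → List Cube
cubes d = cube₁ d ∷ cube₂ d ∷ []

_∈D_ : Cube → Domino → Set
k ∈D d = k ≡ cube₁ d ⊎ k ≡ cube₂ d

memD : Cube → Domino → Bool
memD k d = (k == cube₁ d) ∨ (k == cube₂ d)

-- v(d) = centre of black cube − centre of white cube
-- (difference of centres = difference of the lattice points)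
v : Domino → Z3
v d = if isWhite (cube₁ d) then cube₂ d ⊖ cube₁ d else cube₁ d ⊖ cube₂ d

-- S^u(d0) = int((d0 + [0,∞)u) ∖ d0).  Since this open set is a union of
-- (open) lattice cubes plus shared faces, a (closed) domino d1 meets it
-- iff some cube k of d1 satisfies: k ∉ d0 and k = k0 + m·u for some cube
-- k0 of d0 and some integer m ≥ 1.

shadowStep : Φ → Cube → Cube → Bool
shadowStep u k0 k =
  let w = k ⊖ k0
      m = dot w (vec u)
  in does (+ 0 ℤ.<? m) ∧ (w == (m · vec u))

meets : Φ → Domino → Domino → Bool
meets u d0 d1 =
  any (λ k → not (memD k d0) ∧ any (λ k0 → shadowStep u k0 k) (cubes d0))
      (cubes d1)

τ : Φ → Domino → Domino → ℚ
τ u d0 d1 =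
  if meets u d0 d1 then det3 (v d1) (v d0) (vec u) ℚ./ 4 else ℚ.0ℚ

sumℚ : List ℚ → ℚ
sumℚ = foldr ℚ._+_ ℚ.0ℚ

T : Φ → List Domino → ℚ
T u t = sumℚ (concatMap (λ d0 → map (λ d1 → τ u d0 d1) t) t)

InBox : ℕ → ℕ → ℕ → Cube → Set
InBox L M N (x , y , z) =
  (+ 0 ℤ.≤ x × x ℤ.< + L) × (+ 0 ℤ.≤ y × y ℤ.< + M) × (+ 0 ℤ.≤ z × z ℤ.< + N)

record Tiling (L M N : ℕ) : Set where
  field
    dominoes : List Domino
    inside   : All (λ d → InBox L M N (cube₁ d) × InBox L M N (cube₂ d)) dominoes
    disjoint : AllPairs (λ d d' → ∀ k → k ∈D d → k ∈D d' → ⊥) dominoes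
    covers   : ∀ k → InBox L M N k → Any (λ d → k ∈D d) dominoes
open Tiling public

-- the twist Tw(t) := T^{e_z}(t)  (= T^{e_x}(t) = T^{e_y}(t) for box tilings)
Tw : ∀ {L M N} → Tiling L M N → ℚ
Tw t = T (plus , az) (dominoes t)

MaxtwLE : ℕ → ℕ → ℕ → ℚ → Set
MaxtwLE L M N b = ∀ (t : Tiling L M N) → Tw t ℚ.≤ b

-- A pair (d₀, d₁) contributes to T^{e_z} only if some cube of d₁ lies strictly above a cube of d₀
-- in the same vertical column, and then 4τ = det(v(d₁), v(d₀), e_z) is at most 1, and positive only
-- if one of d₀, d₁ is parallel to e_x and the other to e_y. Labelling each cube by the axis of its
-- domino, 4·Tw is therefore at most the number of pairs of cubes k below k′ in a common column with
-- labels x and y. A column holding a cubes labelled x and b labelled y has at most ab ≤ ⌈N/2⌉⌊N/2⌋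
-- such pairs, and there are LM columns; finally 4⌈N/2⌉⌊N/2⌋ ≤ N².

module Submission where

open import Defs hiding (T)
open import Data.Nat using (ℕ; _*_; _≤_; ⌈_/2⌉; ⌊_/2⌋)
open import Data.Nat.Divisibility using (_∣_)
open import Data.Integer using (+_)
open import Data.Rational using (ℚ; _/_)
open import Data.Product using (_×_)
open import Data.Sum using (_⊎_)

open import Algebra.Properties.CommutativeSemigroup using (interchange)
open import Data.Bool using (Bool; true; false; T; not; _∧_)
open import Data.Bool.ListAction using (any)
open import Data.Bool.Properties using (T-∧)
open import Data.Empty using (⊥-elim)
open import Data.Integer as ℤ using (ℤ)
import Data.Integer.Properties as ℤ
import Data.Integer.Tactic.RingSolver as ℤ-Solver
open import Data.List using (List; []; _∷_; _++_; map; concatMap; length; upTo)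
open import Data.List.Properties using (map-++; map-cong; map-∘; length-map; length-upTo)
open import Data.List.Membership.Propositional using (_∈_; find; lose)
open import Data.List.Membership.Propositional.Properties using (∈-map⁺; ∈-concatMap⁺; ∈-upTo⁺)
open import Data.List.Membership.DecPropositional using (_∈?_)
open import Data.List.Relation.Binary.Disjoint.Propositional using (Disjoint)
open import Data.List.Relation.Unary.All as All using (All; []; _∷_; all?)
import Data.List.Relation.Unary.All.Properties as Allₚ
open import Data.List.Relation.Unary.AllPairs as AllPairs using (AllPairs; []; _∷_)
import Data.List.Relation.Unary.AllPairs.Properties as AllPairsₚ
open import Data.List.Relation.Unary.Any using (here; there; _─_)
open import Data.List.Relation.Unary.Any.Properties using (any⁻)
open import Data.List.Relation.Unary.Unique.Propositional using (Unique)
import Data.List.Relation.Unary.Unique.Propositional.Properties as Uniqueₚ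
open import Data.Nat using (zero; suc; _+_; _<_; z≤n; s≤s; NonZero)
open import Data.Nat.ListAction using (sum)
open import Data.Nat.ListAction.Properties using (sum-++)
open import Data.Nat.Properties
import Data.Nat.Tactic.RingSolver as ℕ-Solver
open import Data.Product using (_,_; proj₁; proj₂; ∃; ∃₂)
import Data.Product.Properties as Product
open import Data.Rational as ℚ using (toℚᵘ)
import Data.Rational.Properties as ℚ
open import Data.Rational.Unnormalised as ℚᵘ using (mkℚᵘ; *≡*; *≤*)
import Data.Rational.Unnormalised.Properties as ℚᵘ
open import Data.Sum using (inj₁; inj₂)
open import Data.Unit using (tt)
open import Function using (_∘_; _on_; Equivalence)
open import Relation.Binary.Definitions using (Decidable; Asymmetric; DecidableEquality)
open import Relation.Binary.PropositionalEquality
open import Relation.Nullary using (Dec; does; yes; no; ¬_)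
open import Relation.Nullary.Decidable using (_×-dec_; toWitness)

private variable
  A B : Set

⌈n/2⌉+⌊n/2⌋≡n : ∀ n → ⌈ n /2⌉ + ⌊ n /2⌋ ≡ n
⌈n/2⌉+⌊n/2⌋≡n n = trans (+-comm ⌈ n /2⌉ ⌊ n /2⌋) (⌊n/2⌋+⌈n/2⌉≡n n)

m*n≤⌈[m+n]/2⌉*⌊[m+n]/2⌋ : ∀ m n → m * n ≤ ⌈ m + n /2⌉ * ⌊ m + n /2⌋
m*n≤⌈[m+n]/2⌉*⌊[m+n]/2⌋ zero    n       = z≤n
m*n≤⌈[m+n]/2⌉*⌊[m+n]/2⌋ (suc m) zero    rewrite *-zeroʳ m = z≤n
m*n≤⌈[m+n]/2⌉*⌊[m+n]/2⌋ (suc m) (suc n) rewrite +-suc m n = begin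
  suc m * suc n                            ≡⟨ suc*suc m n ⟩
  suc (m * n + (m + n))                    ≤⟨ s≤s (+-mono-≤ (m*n≤⌈[m+n]/2⌉*⌊[m+n]/2⌋ m n)
                                                            (≤-reflexive (sym (⌈n/2⌉+⌊n/2⌋≡n (m + n))))) ⟩
  suc (c * f + (c + f))                    ≡⟨ suc*suc c f ⟨
  suc c * suc f                            ∎
  where
  open ≤-Reasoning
  c f : ℕ
  c = ⌈ m + n /2⌉
  f = ⌊ m + n /2⌋
  suc*suc : ∀ a b → suc a * suc b ≡ suc (a * b + (a + b))
  suc*suc = ℕ-Solver.solve-∀

m+n≤o⇒m*n≤⌈o/2⌉*⌊o/2⌋ : ∀ {m n o} → m + n ≤ o → m * n ≤ ⌈ o /2⌉ * ⌊ o /2⌋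
m+n≤o⇒m*n≤⌈o/2⌉*⌊o/2⌋ {m} {n} m+n≤o =
  ≤-trans (m*n≤⌈[m+n]/2⌉*⌊[m+n]/2⌋ m n) (*-mono-≤ (⌈n/2⌉-mono m+n≤o) (⌊n/2⌋-mono m+n≤o))

4*[⌈n/2⌉*⌊n/2⌋]≤n*n : ∀ n → 4 * (⌈ n /2⌉ * ⌊ n /2⌋) ≤ n * n
4*[⌈n/2⌉*⌊n/2⌋]≤n*n zero          = z≤n
4*[⌈n/2⌉*⌊n/2⌋]≤n*n (suc zero)    = z≤n
4*[⌈n/2⌉*⌊n/2⌋]≤n*n (suc (suc n)) = begin
  4 * (suc c * suc f)                      ≡⟨ expand c f ⟩
  4 * (c * f) + 4 * (c + f) + 4            ≤⟨ +-monoˡ-≤ 4 (+-mono-≤ (4*[⌈n/2⌉*⌊n/2⌋]≤n*n n)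
                                                                    (≤-reflexive (cong (4 *_) (⌈n/2⌉+⌊n/2⌋≡n n)))) ⟩
  n * n + 4 * n + 4                        ≡⟨ square n ⟩
  suc (suc n) * suc (suc n)                ∎
  where
  open ≤-Reasoning
  c f : ℕ
  c = ⌈ n /2⌉
  f = ⌊ n /2⌋
  expand : ∀ a b → 4 * (suc a * suc b) ≡ 4 * (a * b) + 4 * (a + b) + 4
  expand = ℕ-Solver.solve-∀
  square : ∀ a → a * a + 4 * a + 4 ≡ suc (suc a) * suc (suc a)
  square = ℕ-Solver.solve-∀

sum-map-+ : ∀ (f g : A → ℕ) xs → sum (map (λ x → f x + g x) xs) ≡ sum (map f xs) + sum (map g xs)
sum-map-+ f g []       = refl
sum-map-+ f g (x ∷ xs) =
  trans (cong (_+_ (f x + g x)) (sum-map-+ f g xs)) (interchange +-commutativeSemigroup (f x) (g x) _ _)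

sum-map-zero : ∀ (xs : List A) → sum (map (λ _ → 0) xs) ≡ 0
sum-map-zero []       = refl
sum-map-zero (_ ∷ xs) = sum-map-zero xs

sum-map-mono : ∀ {f g : A → ℕ} → (∀ x → f x ≤ g x) → ∀ xs → sum (map f xs) ≤ sum (map g xs)
sum-map-mono f≤g []       = z≤n
sum-map-mono f≤g (x ∷ xs) = +-mono-≤ (f≤g x) (sum-map-mono f≤g xs)

sum-map-≤-length* : ∀ {f : A → ℕ} {b} → (∀ x → f x ≤ b) → ∀ xs → sum (map f xs) ≤ length xs * b
sum-map-≤-length* f≤b []       = z≤n
sum-map-≤-length* f≤b (x ∷ xs) = +-mono-≤ (f≤b x) (sum-map-≤-length* f≤b xs)

∈⇒≤sum-map : ∀ (f : A → ℕ) {x xs} → x ∈ xs → f x ≤ sum (map f xs)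
∈⇒≤sum-map f (here refl)                  = m≤m+n _ _
∈⇒≤sum-map f {xs = y ∷ _} (there x∈xs) = ≤-trans (∈⇒≤sum-map f x∈xs) (m≤n+m _ (f y))

sum-map-concatMap : ∀ (f : B → ℕ) (g : A → List B) xs →
  sum (map f (concatMap g xs)) ≡ sum (map (λ x → sum (map f (g x))) xs)
sum-map-concatMap f g []       = refl
sum-map-concatMap f g (x ∷ xs) = begin
  sum (map f (g x ++ concatMap g xs))              ≡⟨ cong sum (map-++ f (g x) _) ⟩
  sum (map f (g x) ++ map f (concatMap g xs))      ≡⟨ sum-++ (map f (g x)) _ ⟩
  sum (map f (g x)) + sum (map f (concatMap g xs)) ≡⟨ cong (_+_ (sum (map f (g x)))) (sum-map-concatMap f g xs) ⟩
  sum (map f (g x)) + sum (map (λ x → sum (map f (g x))) xs) ∎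
  where open ≡-Reasoning

sum-map-sum-comm : ∀ (f : A → B → ℕ) xs ys →
  sum (map (λ x → sum (map (f x) ys)) xs) ≡ sum (map (λ y → sum (map (λ x → f x y) xs)) ys)
sum-map-sum-comm f []       ys = sym (sum-map-zero ys)
sum-map-sum-comm f (x ∷ xs) ys = begin
  sum (map (f x) ys) + sum (map (λ x → sum (map (f x) ys)) xs)
    ≡⟨ cong (_+_ (sum (map (f x) ys))) (sum-map-sum-comm f xs ys) ⟩
  sum (map (f x) ys) + sum (map (λ y → sum (map (λ x → f x y) xs)) ys)
    ≡⟨ sum-map-+ (f x) (λ y → sum (map (λ x → f x y) xs)) ys ⟨
  sum (map (λ y → f x y + sum (map (λ x → f x y) xs)) ys) ∎
  where open ≡-Reasoning

sum-pairs-concatMap : ∀ (F : B → B → ℕ) (g : A → List B) xs →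
  sum (map (λ x → sum (map (λ y → sum (map (λ b → sum (map (F b) (g y))) (g x))) xs)) xs)
    ≡ sum (map (λ b → sum (map (F b) (concatMap g xs))) (concatMap g xs))
sum-pairs-concatMap F g xs = sym (begin
  sum (map (λ b → sum (map (F b) (concatMap g xs))) (concatMap g xs))
    ≡⟨ sum-map-concatMap (λ b → sum (map (F b) (concatMap g xs))) g xs ⟩
  sum (map (λ x → sum (map (λ b → sum (map (F b) (concatMap g xs))) (g x))) xs)
    ≡⟨ cong sum (map-cong (λ x → cong sum (map-cong (λ b → sum-map-concatMap (F b) g xs) (g x))) xs) ⟩
  sum (map (λ x → sum (map (λ b → sum (map (λ y → sum (map (F b) (g y))) xs)) (g x))) xs)
    ≡⟨ cong sum (map-cong (λ x → sum-map-sum-comm (λ b y → sum (map (F b) (g y))) (g x) xs) xs) ⟩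
  sum (map (λ x → sum (map (λ y → sum (map (λ b → sum (map (F b) (g y))) (g x))) xs)) xs) ∎)
  where open ≡-Reasoning

sum-map-─ : ∀ (f : A → ℕ) {x xs} (x∈xs : x ∈ xs) → sum (map f xs) ≡ f x + sum (map f (xs ─ x∈xs))
sum-map-─ f (here refl)                  = refl
sum-map-─ f {x} {y ∷ xs} (there x∈xs) = begin
  f y + sum (map f xs)                  ≡⟨ cong (_+_ (f y)) (sum-map-─ f x∈xs) ⟩
  f y + (f x + sum (map f (xs ─ x∈xs))) ≡⟨ +-assoc (f y) _ _ ⟨
  f y + f x + sum (map f (xs ─ x∈xs))   ≡⟨ cong (_+ sum (map f (xs ─ x∈xs))) (+-comm (f y) (f x)) ⟩
  f x + f y + sum (map f (xs ─ x∈xs))   ≡⟨ +-assoc (f x) _ _ ⟩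
  f x + (f y + sum (map f (xs ─ x∈xs))) ∎
  where open ≡-Reasoning

∈-─ : ∀ {x y : A} {xs} (x∈xs : x ∈ xs) → y ∈ xs → ¬ y ≡ x → y ∈ (xs ─ x∈xs)
∈-─ (here refl)  (here refl)  y≢x = ⊥-elim (y≢x refl)
∈-─ (here refl)  (there y∈xs) y≢x = y∈xs
∈-─ (there x∈xs) (here refl)  y≢x = here refl
∈-─ (there x∈xs) (there y∈xs) y≢x = there (∈-─ x∈xs y∈xs y≢x)

sum-map-Unique-≤ : ∀ (f : A → ℕ) {xs ys} → Unique xs → (∀ {x} → x ∈ xs → 0 < f x → x ∈ ys) →
  sum (map f xs) ≤ sum (map f ys)
sum-map-Unique-≤ f {[]}     []               support = z≤n
sum-map-Unique-≤ f {x ∷ xs} {ys} (x∉xs ∷ unique) support with f x in fx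
... | zero  = sum-map-Unique-≤ f unique (λ y∈xs → support (there y∈xs))
... | suc n = begin
  suc n + sum (map f xs)        ≡⟨ cong (_+ sum (map f xs)) fx ⟨
  f x + sum (map f xs)          ≤⟨ +-monoʳ-≤ (f x) (sum-map-Unique-≤ f unique support′) ⟩
  f x + sum (map f (ys ─ x∈ys)) ≡⟨ sum-map-─ f x∈ys ⟨
  sum (map f ys)                ∎
  where
  open ≤-Reasoning
  x∈ys : x ∈ ys
  x∈ys = support (here refl) (subst (0 <_) (sym fx) (s≤s z≤n))
  support′ : ∀ {y} → y ∈ xs → 0 < f y → y ∈ (ys ─ x∈ys)
  support′ y∈xs 0<fy = ∈-─ x∈ys (support (there y∈xs) 0<fy) (λ { refl → All.lookup x∉xs y∈xs refl })

toℚᵘ-/ : ∀ i n → toℚᵘ (i / suc n) ℚᵘ.≃ mkℚᵘ i n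
toℚᵘ-/ i n = ℚ.toℚᵘ-fromℚᵘ (mkℚᵘ i n)

i*b≤j*a⇒i/a≤j/b : ∀ {i j} a b .{{_ : NonZero a}} .{{_ : NonZero b}} →
  i ℤ.* + b ℤ.≤ j ℤ.* + a → i / a ℚ.≤ j / b
i*b≤j*a⇒i/a≤j/b {i} {j} (suc a) (suc b) i*b≤j*a = ℚ.toℚᵘ-cancel-≤
  (ℚᵘ.≤-respˡ-≃ (ℚᵘ.≃-sym (toℚᵘ-/ i a)) (ℚᵘ.≤-respʳ-≃ (ℚᵘ.≃-sym (toℚᵘ-/ j b)) (*≤* i*b≤j*a)))

i≤j⇒i/4≤j/4 : ∀ {i j} → i ℤ.≤ j → i / 4 ℚ.≤ j / 4
i≤j⇒i/4≤j/4 {i} {j} i≤j = i*b≤j*a⇒i/a≤j/b {i} {j} 4 4 (ℤ.*-monoʳ-≤-nonNeg (+ 4) i≤j)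

[m+n]/4≡m/4+n/4 : ∀ m n → + (m + n) / 4 ≡ + m / 4 ℚ.+ + n / 4
[m+n]/4≡m/4+n/4 m n = ℚ.toℚᵘ-injective (begin
  toℚᵘ (+ (m + n) / 4)                 ≈⟨ toℚᵘ-/ (+ (m + n)) 3 ⟩
  mkℚᵘ (+ (m + n)) 3                   ≈⟨ *≡* (cross-multiply (+ m) (+ n)) ⟩
  mkℚᵘ (+ m) 3 ℚᵘ.+ mkℚᵘ (+ n) 3       ≈⟨ ℚᵘ.+-cong (toℚᵘ-/ (+ m) 3) (toℚᵘ-/ (+ n) 3) ⟨
  toℚᵘ (+ m / 4) ℚᵘ.+ toℚᵘ (+ n / 4)   ≈⟨ ℚ.toℚᵘ-homo-+ (+ m / 4) (+ n / 4) ⟨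
  toℚᵘ (+ m / 4 ℚ.+ + n / 4)           ∎)
  where
  open ℚᵘ.≃-Reasoning
  cross-multiply : ∀ i j → (i ℤ.+ j) ℤ.* + 16 ≡ (i ℤ.* + 4 ℤ.+ j ℤ.* + 4) ℤ.* + 4
  cross-multiply = ℤ-Solver.solve-∀

sumℚ-map-≤ : ∀ (f : A → ℚ) (w : A → ℕ) xs → (∀ {x} → x ∈ xs → f x ℚ.≤ + w x / 4) →
  sumℚ (map f xs) ℚ.≤ + sum (map w xs) / 4
sumℚ-map-≤ f w []       f≤w = ℚ.≤-refl
sumℚ-map-≤ f w (x ∷ xs) f≤w = ℚ.≤-trans
  (ℚ.+-mono-≤ (f≤w (here refl)) (sumℚ-map-≤ f w xs (λ x∈xs → f≤w (there x∈xs))))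
  (ℚ.≤-reflexive (sym ([m+n]/4≡m/4+n/4 (w x) (sum (map w xs)))))

sumℚ-++ : ∀ ps qs → sumℚ (ps ++ qs) ≡ sumℚ ps ℚ.+ sumℚ qs
sumℚ-++ []       qs = sym (ℚ.+-identityˡ (sumℚ qs))
sumℚ-++ (p ∷ ps) qs = trans (cong (p ℚ.+_) (sumℚ-++ ps qs)) (sym (ℚ.+-assoc p (sumℚ ps) (sumℚ qs)))

sumℚ-pairs-≤ : ∀ (f : A → B → ℚ) (w : A → B → ℕ) xs ys →
  (∀ {x y} → x ∈ xs → y ∈ ys → f x y ℚ.≤ + w x y / 4) →
  sumℚ (concatMap (λ x → map (f x) ys) xs) ℚ.≤ + sum (map (λ x → sum (map (w x) ys)) xs) / 4
sumℚ-pairs-≤ f w []       ys f≤w = ℚ.≤-refl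
sumℚ-pairs-≤ f w (x ∷ xs) ys f≤w = begin
  sumℚ (map (f x) ys ++ concatMap (λ x → map (f x) ys) xs)
    ≡⟨ sumℚ-++ (map (f x) ys) _ ⟩
  sumℚ (map (f x) ys) ℚ.+ sumℚ (concatMap (λ x → map (f x) ys) xs)
    ≤⟨ ℚ.+-mono-≤ (sumℚ-map-≤ (f x) (w x) ys (f≤w (here refl)))
                  (sumℚ-pairs-≤ f w xs ys (λ x∈xs → f≤w (there x∈xs))) ⟩
  + sum (map (w x) ys) / 4 ℚ.+ + sum (map (λ x → sum (map (w x) ys)) xs) / 4
    ≡⟨ [m+n]/4≡m/4+n/4 (sum (map (w x) ys)) _ ⟨
  + sum (map (λ x → sum (map (w x) ys)) (x ∷ xs)) / 4 ∎
  where open ℚ.≤-Reasoning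

-- Perpendicular pairs in a list of labelled cubes

δ : Axis → Axis → ℕ
δ ax ax = 1
δ ay ay = 1
δ az az = 1
δ _  _  = 0

perp : Axis → Axis → ℕ
perp ax b = δ ay b
perp ay b = δ ax b
perp az b = 0

perp-comm : ∀ a b → perp a b ≡ perp b a
perp-comm ax ax = refl
perp-comm ax ay = refl
perp-comm ax az = refl
perp-comm ay ax = refl
perp-comm ay ay = refl
perp-comm ay az = refl
perp-comm az ax = refl
perp-comm az ay = refl
perp-comm az az = refl

module PerpendicularPairs {C : Set} {_≺_ : C → C → Set}
  (_≺?_ : Decidable _≺_) (≺-asym : Asymmetric _≺_) (s : C → Axis) where

  weight : C → C → ℕ
  weight k k′ with k ≺? k′
  ... | yes _ = perp (s k) (s k′)
  ... | no  _ = 0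

  count : Axis → List C → ℕ
  count a ks = sum (map (λ k → δ a (s k)) ks)

  pairs : List C → ℕ
  pairs ks = sum (map (λ k → sum (map (weight k) ks)) ks)

  weight-≺ : ∀ {k k′} → k ≺ k′ → weight k k′ ≡ perp (s k) (s k′)
  weight-≺ {k} {k′} k≺k′ with k ≺? k′
  ... | yes _    = refl
  ... | no  k⊀k′ = ⊥-elim (k⊀k′ k≺k′)

  0<weight⇒≺ : ∀ {k k′} → 0 < weight k k′ → k ≺ k′
  0<weight⇒≺ {k} {k′} 0<w with k ≺? k′
  ... | yes k≺k′ = k≺k′
  ... | no  _    = ⊥-elim (<-irrefl refl 0<w)

  weight-irrefl : ∀ k → weight k k ≡ 0
  weight-irrefl k with k ≺? k
  ... | yes k≺k = ⊥-elim (≺-asym k≺k k≺k)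
  ... | no  _   = refl

  weight+weight≤perp : ∀ k k′ → weight k k′ + weight k′ k ≤ perp (s k) (s k′)
  weight+weight≤perp k k′ with k ≺? k′ | k′ ≺? k
  ... | yes k≺k′ | yes k′≺k = ⊥-elim (≺-asym k≺k′ k′≺k)
  ... | yes _    | no  _    = ≤-reflexive (+-identityʳ _)
  ... | no  _    | yes _    = ≤-reflexive (perp-comm (s k′) (s k))
  ... | no  _    | no  _    = z≤n

  sum-perp+count*count≤ : ∀ a ks →
    sum (map (λ k → perp a (s k)) ks) + count ax ks * count ay ks
      ≤ (δ ax a + count ax ks) * (δ ay a + count ay ks)
  sum-perp+count*count≤ ax ks = ≤-refl
  sum-perp+count*count≤ ay ks = ≤-reflexive (sym (*-suc (count ax ks) (count ay ks)))
  sum-perp+count*count≤ az ks = ≤-reflexive (cong (_+ count ax ks * count ay ks) (sum-map-zero ks))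

  pairs≤count*count : ∀ ks → pairs ks ≤ count ax ks * count ay ks
  pairs≤count*count []       = z≤n
  pairs≤count*count (k ∷ ks) = begin
    weight k k + sum (map (weight k) ks) + sum (map (λ w → weight w k + sum (map (weight w) ks)) ks)
      ≡⟨ cong₂ _+_ (cong (_+ sum (map (weight k) ks)) (weight-irrefl k))
                   (sum-map-+ (λ w → weight w k) (λ w → sum (map (weight w) ks)) ks) ⟩
    sum (map (weight k) ks) + (sum (map (λ w → weight w k) ks) + pairs ks)
      ≡⟨ +-assoc (sum (map (weight k) ks)) _ _ ⟨
    sum (map (weight k) ks) + sum (map (λ w → weight w k) ks) + pairs ks
      ≡⟨ cong (_+ pairs ks) (sum-map-+ (weight k) (λ w → weight w k) ks) ⟨
    sum (map (λ w → weight k w + weight w k) ks) + pairs ks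
      ≤⟨ +-mono-≤ (sum-map-mono (weight+weight≤perp k) ks) (pairs≤count*count ks) ⟩
    sum (map (λ w → perp (s k) (s w)) ks) + count ax ks * count ay ks
      ≤⟨ sum-perp+count*count≤ (s k) ks ⟩
    count ax (k ∷ ks) * count ay (k ∷ ks) ∎
    where open ≤-Reasoning

  count+count≤length : ∀ ks → count ax ks + count ay ks ≤ length ks
  count+count≤length []       = z≤n
  count+count≤length (k ∷ ks) with s k
  ... | ax = s≤s (count+count≤length ks)
  ... | ay = ≤-trans (≤-reflexive (+-suc (count ax ks) (count ay ks))) (s≤s (count+count≤length ks))
  ... | az = m≤n⇒m≤1+n (count+count≤length ks)

  pairs≤⌈length/2⌉*⌊length/2⌋ : ∀ ks → pairs ks ≤ ⌈ length ks /2⌉ * ⌊ length ks /2⌋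
  pairs≤⌈length/2⌉*⌊length/2⌋ ks =
    ≤-trans (pairs≤count*count ks) (m+n≤o⇒m*n≤⌈o/2⌉*⌊o/2⌋ {count ax ks} {count ay ks} (count+count≤length ks))

-- Dominoes and the density τ

-- toWitness is stated with isYes, which does not compute on _×-dec_.
T-does⇒ : ∀ {A : Set} (a? : Dec A) → T (does a?) → A
T-does⇒ (yes a) _ = a
T-does⇒ (no _)  ()

Above : Cube → Cube → Set
Above (x , y , z) (x′ , y′ , z′) = x ≡ x′ × y ≡ y′ × z ℤ.< z′

above? : Decidable Above
above? (x , y , z) (x′ , y′ , z′) = x ℤ.≟ x′ ×-dec y ℤ.≟ y′ ×-dec z ℤ.<? z′

above-asym : Asymmetric Above
above-asym (refl , refl , z<z′) (_ , _ , z′<z) = ℤ.<-asym z<z′ z′<z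

shadow⇒above : ∀ k₀ k → T (shadowStep (plus , az) k₀ k) → Above k₀ k
shadow⇒above (x₀ , y₀ , z₀) (x , y , z) h =
  let 0<m , x-x₀≡m·0 , y-y₀≡m·0 , _ = T-does⇒ shadow? h in
    sym (ℤ.i-j≡0⇒i≡j x x₀ (trans x-x₀≡m·0 (ℤ.*-zeroʳ m)))
    , sym (ℤ.i-j≡0⇒i≡j y y₀ (trans y-y₀≡m·0 (ℤ.*-zeroʳ m)))
    , subst₂ ℤ._<_ (ℤ.+-identityˡ z₀) (m+z₀≡z x x₀ y y₀ z z₀) (ℤ.+-monoˡ-< z₀ 0<m)
  where
  m : ℤ
  m = (x ℤ.- x₀) ℤ.* + 0 ℤ.+ (y ℤ.- y₀) ℤ.* + 0 ℤ.+ (z ℤ.- z₀) ℤ.* + 1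
  shadow? : Dec (+ 0 ℤ.< m × x ℤ.- x₀ ≡ m ℤ.* + 0 × y ℤ.- y₀ ≡ m ℤ.* + 0 × z ℤ.- z₀ ≡ m ℤ.* + 1)
  shadow? = + 0 ℤ.<? m ×-dec x ℤ.- x₀ ℤ.≟ m ℤ.* + 0 ×-dec y ℤ.- y₀ ℤ.≟ m ℤ.* + 0 ×-dec z ℤ.- z₀ ℤ.≟ m ℤ.* + 1
  m+z₀≡z : ∀ x x₀ y y₀ z z₀ →
    (x ℤ.- x₀) ℤ.* + 0 ℤ.+ (y ℤ.- y₀) ℤ.* + 0 ℤ.+ (z ℤ.- z₀) ℤ.* + 1 ℤ.+ z₀ ≡ z
  m+z₀≡z = ℤ-Solver.solve-∀

[b⊕w]⊖b≡w : ∀ b w → (b ⊕ w) ⊖ b ≡ w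
[b⊕w]⊖b≡w (x , y , z) (p , q , r) = cong₂ _,_ (lemma x p) (cong₂ _,_ (lemma y q) (lemma z r))
  where
  lemma : ∀ x p → (x ℤ.+ p) ℤ.- x ≡ p
  lemma = ℤ-Solver.solve-∀

b⊖[b⊕w]≡-w : ∀ b w → b ⊖ (b ⊕ w) ≡ (ℤ.- + 1) · w
b⊖[b⊕w]≡-w (x , y , z) (p , q , r) = cong₂ _,_ (lemma x p) (cong₂ _,_ (lemma y q) (lemma z r))
  where
  lemma : ∀ x p → x ℤ.- (x ℤ.+ p) ≡ ℤ.- + 1 ℤ.* p
  lemma = ℤ-Solver.solve-∀

v≡±e-axis : ∀ d → ∃ λ s → v d ≡ vec (s , axis d)
v≡±e-axis d with isWhite (cube₁ d)
... | true  = plus  , [b⊕w]⊖b≡w (base d) (e (axis d))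
... | false = minus , b⊖[b⊕w]≡-w (base d) (e (axis d))

units : List Φ
units = (plus , ax) ∷ (plus , ay) ∷ (plus , az) ∷ (minus , ax) ∷ (minus , ay) ∷ (minus , az) ∷ []

∈units : ∀ u → u ∈ units
∈units (plus  , ax) = here refl
∈units (plus  , ay) = there (here refl)
∈units (plus  , az) = there (there (here refl))
∈units (minus , ax) = there (there (there (here refl)))
∈units (minus , ay) = there (there (there (there (here refl))))
∈units (minus , az) = there (there (there (there (there (here refl)))))

DetBound : Φ → Φ → Set
DetBound u₀ u₁ = det3 (vec u₁) (vec u₀) (e az) ℤ.≤ + perp (proj₂ u₀) (proj₂ u₁)

detBound? : ∀ u₀ u₁ → Dec (DetBound u₀ u₁)
detBound? u₀ u₁ = det3 (vec u₁) (vec u₀) (e az) ℤ.≤? + perp (proj₂ u₀) (proj₂ u₁)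

det≤perp : ∀ u₀ u₁ → DetBound u₀ u₁
det≤perp u₀ u₁ = All.lookup (All.lookup checked (∈units u₀)) (∈units u₁)
  where
  checked : All (λ u₀ → All (DetBound u₀) units) units
  checked = toWitness {a? = all? (λ u₀ → all? (detBound? u₀) units) units} tt

cube₁≢cube₂ : ∀ d → ¬ cube₁ d ≡ cube₂ d
cube₁≢cube₂ (dom (x , y , z) ax) eq = ℤ.i≢suc[i] (trans (cong proj₁ eq) (ℤ.+-comm x (+ 1)))
cube₁≢cube₂ (dom (x , y , z) ay) eq = ℤ.i≢suc[i] (trans (cong (proj₁ ∘ proj₂) eq) (ℤ.+-comm y (+ 1)))
cube₁≢cube₂ (dom (x , y , z) az) eq = ℤ.i≢suc[i] (trans (cong (proj₂ ∘ proj₂) eq) (ℤ.+-comm z (+ 1)))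

∈cubes⇒∈D : ∀ {k d} → k ∈ cubes d → k ∈D d
∈cubes⇒∈D (here refl)         = inj₁ refl
∈cubes⇒∈D (there (here refl)) = inj₂ refl

_≟ᶜ_ : DecidableEquality Cube
_≟ᶜ_ = Product.≡-dec ℤ._≟_ (Product.≡-dec ℤ._≟_ ℤ._≟_)

axisAt : List Domino → Cube → Axis
axisAt []      k = az
axisAt (d ∷ t) k with _∈?_ _≟ᶜ_ k (cubes d)
... | yes _ = axis d
... | no  _ = axisAt t k

axisAt-∈ : ∀ {t d k} → AllPairs (Disjoint on cubes) t → d ∈ t → k ∈ cubes d → axisAt t k ≡ axis d
axisAt-∈ {d′ ∷ t} {d} {k} (d′-disj ∷ t-disj) d∈t k∈d with _∈?_ _≟ᶜ_ k (cubes d′) | d∈t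
... | yes _    | here refl = refl
... | yes k∈d′ | there d∈t′ = ⊥-elim (All.lookup d′-disj d∈t′ (k∈d′ , k∈d))
... | no  k∉d′ | here refl = ⊥-elim (k∉d′ k∈d)
... | no  _    | there d∈t′ = axisAt-∈ t-disj d∈t′ k∈d

meets⇒above : ∀ d₀ d₁ → T (meets (plus , az) d₀ d₁) →
  ∃₂ λ k₀ k₁ → k₀ ∈ cubes d₀ × k₁ ∈ cubes d₁ × Above k₀ k₁
meets⇒above d₀ d₁ h =
  let k₁ , k₁∈d₁ , h₁ = find (any⁻ (λ k → not (memD k d₀) ∧ any (inShadowOf k) (cubes d₀)) (cubes d₁) h)
      k₀ , k₀∈d₀ , h₀ = find (any⁻ (inShadowOf k₁) (cubes d₀) (proj₂ (Equivalence.to T-∧ h₁)))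
  in k₀ , k₁ , k₀∈d₀ , k₁∈d₁ , shadow⇒above k₀ k₁ h₀
  where
  inShadowOf : Cube → Cube → Bool
  inShadowOf k k₀ = shadowStep (plus , az) k₀ k

module Weights (t : List Domino) = PerpendicularPairs above? above-asym (axisAt t)

dominoWeight : List Domino → Domino → Domino → ℕ
dominoWeight t d₀ d₁ = sum (map (λ k₀ → sum (map (Weights.weight t k₀) (cubes d₁))) (cubes d₀))

perp≤dominoWeight : ∀ {t d₀ d₁} → AllPairs (Disjoint on cubes) t → d₀ ∈ t → d₁ ∈ t →
  T (meets (plus , az) d₀ d₁) → perp (axis d₀) (axis d₁) ≤ dominoWeight t d₀ d₁
perp≤dominoWeight {t} {d₀} {d₁} disj d₀∈t d₁∈t meets-d₀-d₁ =
  let k₀ , k₁ , k₀∈d₀ , k₁∈d₁ , k₀<k₁ = meets⇒above d₀ d₁ meets-d₀-d₁ in begin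
  perp (axis d₀) (axis d₁)                   ≡⟨ cong₂ perp (axisAt-∈ disj d₀∈t k₀∈d₀) (axisAt-∈ disj d₁∈t k₁∈d₁) ⟨
  perp (axisAt t k₀) (axisAt t k₁)           ≡⟨ Weights.weight-≺ t k₀<k₁ ⟨
  Weights.weight t k₀ k₁                     ≤⟨ ∈⇒≤sum-map (Weights.weight t k₀) k₁∈d₁ ⟩
  sum (map (Weights.weight t k₀) (cubes d₁)) ≤⟨ ∈⇒≤sum-map (λ k → sum (map (Weights.weight t k) (cubes d₁))) k₀∈d₀ ⟩
  dominoWeight t d₀ d₁                       ∎
  where open ≤-Reasoning

det-v≤perp : ∀ d₀ d₁ → det3 (v d₁) (v d₀) (vec (plus , az)) ℤ.≤ + perp (axis d₀) (axis d₁)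
det-v≤perp d₀ d₁ with s₀ , v₀ ← v≡±e-axis d₀ | s₁ , v₁ ← v≡±e-axis d₁ rewrite v₀ | v₁ =
  det≤perp (s₀ , axis d₀) (s₁ , axis d₁)

τ≤perp/4 : ∀ d₀ d₁ {w} → (T (meets (plus , az) d₀ d₁) → perp (axis d₀) (axis d₁) ≤ w) →
  τ (plus , az) d₀ d₁ ℚ.≤ + w / 4
τ≤perp/4 d₀ d₁ {w} perp≤w with meets (plus , az) d₀ d₁
... | false = i≤j⇒i/4≤j/4 {+ 0} {+ w} (ℤ.+≤+ z≤n)
... | true  = i≤j⇒i/4≤j/4 {det3 (v d₁) (v d₀) (vec (plus , az))} {+ w}
  -- The with-abstraction has turned perp≤w into a function on T true.
  (ℤ.≤-trans (det-v≤perp d₀ d₁) (ℤ.+≤+ (perp≤w tt)))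

-- Columns of the box

module Box (L M N : ℕ) where

  column : ℤ → ℤ → List Cube
  column x y = map (λ z → x , y , + z) (upTo N)

  columnOf : Cube → List Cube
  columnOf (x , y , _) = column x y

  box : List Cube
  box = concatMap (λ x → concatMap (λ y → column (+ x) (+ y)) (upTo M)) (upTo L)

  InBox⇒∈box : ∀ {k} → InBox L M N k → k ∈ box
  InBox⇒∈box ((ℤ.+≤+ _ , ℤ.+<+ x<L) , (ℤ.+≤+ _ , ℤ.+<+ y<M) , (ℤ.+≤+ _ , ℤ.+<+ z<N)) =
    ∈-concatMap⁺ _ (lose (∈-upTo⁺ x<L) (∈-concatMap⁺ _ (lose (∈-upTo⁺ y<M) (∈-map⁺ _ (∈-upTo⁺ z<N)))))

  above⇒∈columnOf : ∀ {k k′} → InBox L M N k′ → Above k k′ → k′ ∈ columnOf k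
  above⇒∈columnOf (_ , _ , (ℤ.+≤+ _ , ℤ.+<+ z′<N)) (refl , refl , _) = ∈-map⁺ _ (∈-upTo⁺ z′<N)

  sum-box≤ : ∀ (f : Cube → ℕ) {b} → (∀ x y → sum (map f (column x y)) ≤ b) → sum (map f box) ≤ L * (M * b)
  sum-box≤ f {b} f≤b = begin
    sum (map f box)
      ≡⟨ sum-map-concatMap f _ (upTo L) ⟩
    sum (map (λ x → sum (map f (concatMap (λ y → column (+ x) (+ y)) (upTo M)))) (upTo L))
      ≤⟨ sum-map-≤-length* column-sums≤ (upTo L) ⟩
    length (upTo L) * (length (upTo M) * b)
      ≡⟨ cong₂ (λ l m → l * (m * b)) (length-upTo L) (length-upTo M) ⟩
    L * (M * b) ∎
    where
    open ≤-Reasoning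
    column-sums≤ : ∀ x → sum (map f (concatMap (λ y → column (+ x) (+ y)) (upTo M))) ≤ length (upTo M) * b
    column-sums≤ x = ≤-trans (≤-reflexive (sum-map-concatMap f _ (upTo M)))
                             (sum-map-≤-length* (λ y → f≤b (+ x) (+ y)) (upTo M))

  column-pairs≤ : ∀ t x y →
    sum (map (λ k → sum (map (Weights.weight t k) (columnOf k))) (column x y)) ≤ ⌈ N /2⌉ * ⌊ N /2⌋
  column-pairs≤ t x y = begin
    sum (map (λ k → sum (map (Weights.weight t k) (columnOf k))) (column x y))
      -- columnOf k reduces to column x y once the two maps are fused
      ≡⟨ cong sum (trans (sym (map-∘ (upTo N))) (map-∘ (upTo N))) ⟩
    Weights.pairs t (column x y)
      ≤⟨ Weights.pairs≤⌈length/2⌉*⌊length/2⌋ t (column x y) ⟩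
    ⌈ length (column x y) /2⌉ * ⌊ length (column x y) /2⌋
      ≡⟨ cong (λ n → ⌈ n /2⌉ * ⌊ n /2⌋) (trans (length-map _ (upTo N)) (length-upTo N)) ⟩
    ⌈ N /2⌉ * ⌊ N /2⌋ ∎
    where open ≤-Reasoning

  module _ (t : Tiling L M N) where
    private
      ds : List Domino
      ds = dominoes t
      tiled : List Cube
      tiled = concatMap cubes ds
      weight : Cube → Cube → ℕ
      weight = Weights.weight ds

    disjoint-cubes : AllPairs (Disjoint on cubes) ds
    disjoint-cubes = AllPairs.map
      (λ {d} {d′} d-disj {k} (k∈d , k∈d′) → d-disj k (∈cubes⇒∈D {d = d} k∈d) (∈cubes⇒∈D {d = d′} k∈d′))
      (disjoint t)

    tiled-unique : Unique tiled
    tiled-unique = Uniqueₚ.concat⁺ (Allₚ.map⁺ (All.universal cubes-unique ds)) (AllPairsₚ.map⁺ disjoint-cubes)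
      where
      cubes-unique : ∀ d → Unique (cubes d)
      cubes-unique d = (cube₁≢cube₂ d ∷ []) ∷ [] ∷ []

    tiled-inBox : All (InBox L M N) tiled
    tiled-inBox = Allₚ.concat⁺ (Allₚ.map⁺ (All.map (λ (k₁ , k₂) → k₁ ∷ k₂ ∷ []) (inside t)))

    total-weight≤ : sum (map (λ d₀ → sum (map (dominoWeight ds d₀) ds)) ds) ≤ L * M * ⌈ N /2⌉ * ⌊ N /2⌋
    total-weight≤ = begin
      sum (map (λ d₀ → sum (map (dominoWeight ds d₀) ds)) ds)
        ≡⟨ sum-pairs-concatMap weight cubes ds ⟩
      sum (map (λ k → sum (map (weight k) tiled)) tiled)
        ≤⟨ sum-map-mono (λ k → sum-map-Unique-≤ (weight k) {ys = columnOf k} tiled-unique (λ k′∈tiled 0<w →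
             above⇒∈columnOf (All.lookup tiled-inBox k′∈tiled) (Weights.0<weight⇒≺ ds 0<w))) tiled ⟩
      sum (map (λ k → sum (map (weight k) (columnOf k))) tiled)
        ≤⟨ sum-map-Unique-≤ _ tiled-unique (λ k∈tiled _ → InBox⇒∈box (All.lookup tiled-inBox k∈tiled)) ⟩
      sum (map (λ k → sum (map (weight k) (columnOf k))) box)
        ≤⟨ sum-box≤ _ (column-pairs≤ ds) ⟩
      L * (M * (⌈ N /2⌉ * ⌊ N /2⌋))
        ≡⟨ trans (*-assoc (L * M) ⌈ N /2⌉ ⌊ N /2⌋) (*-assoc L M _) ⟨
      L * M * ⌈ N /2⌉ * ⌊ N /2⌋ ∎
      where open ≤-Reasoning

    twist≤ : Tw t ℚ.≤ + (L * M * ⌈ N /2⌉ * ⌊ N /2⌋) / 4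
    twist≤ = ℚ.≤-trans
      (sumℚ-pairs-≤ (τ (plus , az)) (dominoWeight ds) ds ds
                    (λ {d₀} {d₁} d₀∈ds d₁∈ds → τ≤perp/4 d₀ d₁ (perp≤dominoWeight disjoint-cubes d₀∈ds d₁∈ds)))
      (i≤j⇒i/4≤j/4 {+ sum (map (λ d₀ → sum (map (dominoWeight ds d₀) ds)) ds)} {+ (L * M * ⌈ N /2⌉ * ⌊ N /2⌋)}
                   (ℤ.+≤+ total-weight≤))

m*⌈n/2⌉*⌊n/2⌋/4≤m*n²/16 : ∀ m n → + (m * ⌈ n /2⌉ * ⌊ n /2⌋) / 4 ℚ.≤ + (m * (n * n)) / 16
m*⌈n/2⌉*⌊n/2⌋/4≤m*n²/16 m n = i*b≤j*a⇒i/a≤j/b {+ (m * ⌈ n /2⌉ * ⌊ n /2⌋)} {+ (m * (n * n))} 4 16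
  (subst₂ ℤ._≤_ (ℤ.pos-* (m * ⌈ n /2⌉ * ⌊ n /2⌋) 16) (ℤ.pos-* (m * (n * n)) 4) (ℤ.+≤+ (begin
    m * ⌈ n /2⌉ * ⌊ n /2⌋ * 16       ≡⟨ regroup m ⌈ n /2⌉ ⌊ n /2⌋ ⟩
    m * (4 * (⌈ n /2⌉ * ⌊ n /2⌋)) * 4 ≤⟨ *-monoˡ-≤ 4 (*-monoʳ-≤ m (4*[⌈n/2⌉*⌊n/2⌋]≤n*n n)) ⟩
    m * (n * n) * 4                   ∎)))
  where
  open ≤-Reasoning
  regroup : ∀ a b c → a * b * c * 16 ≡ a * (4 * (b * c)) * 4
  regroup = ℕ-Solver.solve-∀

lemma5p1 : (L M N : ℕ) → 1 ≤ L → 1 ≤ M → 1 ≤ N → (2 ∣ L ⊎ 2 ∣ M ⊎ 2 ∣ N) → N ≤ M → M ≤ L →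
    MaxtwLE L M N (+ (L * M * ⌈ N /2⌉ * ⌊ N /2⌋) / 4)
    × (+ (L * M * ⌈ N /2⌉ * ⌊ N /2⌋) / 4) Data.Rational.≤ (+ (L * M * (N * N)) / 16)
lemma5p1 L M N _ _ _ _ _ _ = Box.twist≤ L M N , m*⌈n/2⌉*⌊n/2⌋/4≤m*n²/16 (L * M) N
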